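{- Let $r,n$ be positive integers such that $e\left(\frac{1}{2}\log(2n-1)+1\right)\leq r\leq n$. Then for any positive integers $s_1,\ldots,s_r$, $\overline{H}_n(s_1,\ldots,s_r)$ is not an integer.
   Context: $\overline{H}_n(s_1,\ldots,s_r)=\sum_{0\leq k_1<\cdots<k_r\leq n-1}\prod_{j=1}^{r}(2k_j+1)^{ -s_j}$; $\log$ is the natural logarithm. -}

module Defs where

open import Data.Nat using (ℕ; zero; suc; _+_; _*_; _∸_; _^_; _!)
open import Data.Nat.Properties using (m^n≢0)
open import Data.Nat.Properties using (_!≢0)
open import Data.Integer using (ℤ; +_)
open import Data.Rational using (ℚ; _/_; 0ℚ; 1ℚ; _≤_)
  renaming (_+_ to _+ℚ_; _*_ to _*ℚ_)
open import Data.Product using (Σ)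
open import Relation.Binary.PropositionalEquality using (_≡_)
open import Data.Vec using (Vec; []; _∷_)

sumℚ : ℕ → (ℕ → ℚ) → ℚ
sumℚ zero    f = 0ℚ
sumℚ (suc m) f = sumℚ m f +ℚ f m

oddInvPow : ℕ → ℕ → ℚ
oddInvPow k s = ((+ 1) / (suc (2 * k) ^ s)) {{m^n≢0 (suc (2 * k)) s}}

-- Hbar-from lo n (s_1,…,s_r) = Σ_{lo ≤ k_1 < ⋯ < k_r ≤ n-1} Π_j (2k_j+1)^{-s_j}
HbarFrom : ∀ {r} → ℕ → ℕ → Vec ℕ r → ℚ
HbarFrom lo n []       = 1ℚ
HbarFrom lo n (s ∷ ss) =
  sumℚ (n ∸ lo) (λ i → oddInvPow (lo + i) s *ℚ HbarFrom (suc (lo + i)) n ss)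

Hbar : ∀ {r} → ℕ → Vec ℕ r → ℚ
Hbar n s = HbarFrom 0 n s

ePartial : ℕ → ℚ
ePartial K = sumℚ K (λ j → ((+ 1) / (j !)) {{j !≢0}})

-- Partial sums of ½ log(2n-1) = artanh((n-1)/n) = Σ_{j ≥ 0} y^{2j+1}/(2j+1),
-- y = (n-1)/n (valid for n ≥ 1; here written with  suc (n ∸ 1)  = n).
halfLogPartial : ℕ → ℕ → ℚ
halfLogPartial n K =
  sumℚ K (λ j →
    (((+ ((n ∸ 1) ^ suc (2 * j))) / (suc (n ∸ 1) ^ suc (2 * j)))
       {{m^n≢0 (suc (n ∸ 1)) (suc (2 * j))}})
    *ℚ ((+ 1) / suc (2 * j)))

-- Since all series terms are nonnegative and the partial sums increase to
-- e and ½log(2n-1) respectively, the real number e(½log(2n-1)+1) is the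
-- supremum of the partial products; hence
--   e(½log(2n-1)+1) ≤ r   ⇔   ∀ K, ePartial K · (halfLogPartial n K + 1) ≤ r.
BoundHolds : ℕ → ℕ → Set
BoundHolds r n = ∀ (K : ℕ) →
  ePartial K *ℚ (halfLogPartial n K +ℚ 1ℚ) ≤ (+ r) / 1

IsInteger : ℚ → Set
IsInteger q = Σ ℤ (λ z → q ≡ z / 1)

{-# OPTIONS --safe #-}
-- Let T = H̄_n(1) = Σ_{k<n} 1/(2k+1). Every increasing r-tuple of indices occurs r! times in the
-- expansion of T^r and s_j ≥ 1 only shrinks the terms, so r!·H̄_n(s) ≤ T^r; this is proved by
-- telescoping (r+1)·a·b^r + b^(r+1) ≤ (a+b)^(r+1) over the tail sums of T. Bernoulli's inequality
-- 1 - ((n-1)/n)^M ≤ M/n compares 1/M with the artanh series term y^M/M for y = (n-1)/n, giving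
-- T ≤ ½log(2n-1) + 1, so e·T ≤ r. The binomial theorem gives (1+1/k)^k ≤ e, whence r^r < r!·e^r.
-- Altogether 0 < H̄_n(s) ≤ (e·T)^r / (r!·e^r) ≤ r^r / (r!·e^r) < 1. Here e and ½log(2n-1) only
-- enter through their partial sums with n+1 terms, which is what BoundHolds provides.
module Submission where

open import Data.Nat as ℕ using (ℕ; zero; suc; _∸_; _!; z≤n; s≤s)
import Data.Nat.Properties as ℕP
open import Data.Nat.Combinatorics using (_C_; nCk+nC[k+1]≡[n+1]C[k+1])
open import Data.Nat.Tactic.RingSolver using (solve-∀)
open import Data.Integer as ℤ using (+_; -[1+_])
import Data.Integer.Properties as ℤP
import Data.Fin as Fin
import Data.Fin.Properties as Fin
open import Data.Vec using (Vec; []; _∷_; lookup)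
open import Data.Product using (_,_)
open import Relation.Nullary using (¬_)
open import Relation.Binary.PropositionalEquality
open import Algebra.Bundles using (CommutativeSemiring; CommutativeRing)
open import Defs

module _ where
  open import Data.Nat using (_+_; _*_; _^_; _≤_; _<_)
  open ℕP using (≤-refl; ≤-reflexive; +-mono-≤; +-monoˡ-≤; +-monoʳ-≤; *-monoʳ-≤; *-monoˡ-≤; ^-monoˡ-≤;
                 m≤n+m; ^-distribˡ-+-*; m+[n∸m]≡n)
  open ℕP.≤-Reasoning

  0<n∸m⇒m<n : ∀ {m n} → 0 < n ∸ m → m < n
  0<n∸m⇒m<n 0<n∸m = ℕP.m∸n≢0⇒n<m (λ n∸m≡0 → ℕP.<-irrefl (sym n∸m≡0) 0<n∸m)

  [a+b]^[1+m]≤b^[1+m]+[1+m]*a*[a+b]^m : ∀ a b m → (a + b) ^ suc m ≤ b ^ suc m + suc m * a * (a + b) ^ m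
  [a+b]^[1+m]≤b^[1+m]+[1+m]*a*[a+b]^m a b zero = ≤-reflexive (base a b)
    where
    base : ∀ a b → (a + b) * 1 ≡ b * 1 + 1 * a * 1
    base = solve-∀
  [a+b]^[1+m]≤b^[1+m]+[1+m]*a*[a+b]^m a b (suc m) = begin
    (a + b) * (a + b) ^ suc m
      ≤⟨ *-monoʳ-≤ (a + b) ([a+b]^[1+m]≤b^[1+m]+[1+m]*a*[a+b]^m a b m) ⟩
    (a + b) * (b ^ suc m + suc m * a * (a + b) ^ m)
      ≡⟨ expand a b (b ^ m) ((a + b) ^ m) m ⟩
    b ^ suc (suc m) + a * b ^ suc m + suc m * a * (a + b) ^ suc m
      ≤⟨ +-monoˡ-≤ _ (+-monoʳ-≤ (b ^ suc (suc m)) (*-monoʳ-≤ a (^-monoˡ-≤ (suc m) (m≤n+m b a)))) ⟩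
    b ^ suc (suc m) + a * (a + b) ^ suc m + suc m * a * (a + b) ^ suc m
      ≡⟨ collect (b ^ suc (suc m)) a ((a + b) ^ suc m) m ⟩
    b ^ suc (suc m) + suc (suc m) * a * (a + b) ^ suc m ∎
    where
    expand : ∀ a b B Q m →
      (a + b) * (b * B + suc m * a * Q) ≡ b * (b * B) + a * (b * B) + suc m * a * ((a + b) * Q)
    expand = solve-∀
    collect : ∀ B a Q m → B + a * Q + suc m * a * Q ≡ B + suc (suc m) * a * Q
    collect = solve-∀

  [1+m]*a*b^m+b^[1+m]≤[a+b]^[1+m] : ∀ a b m → suc m * a * b ^ m + b ^ suc m ≤ (a + b) ^ suc m
  [1+m]*a*b^m+b^[1+m]≤[a+b]^[1+m] a b zero = ≤-reflexive (base a b)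
    where
    base : ∀ a b → 1 * a * 1 + b * 1 ≡ (a + b) * 1
    base = solve-∀
  [1+m]*a*b^m+b^[1+m]≤[a+b]^[1+m] a b (suc m) = begin
    suc (suc m) * a * b ^ suc m + b ^ suc (suc m)
      ≤⟨ m≤n+m _ (suc m * a * a * b ^ m) ⟩
    suc m * a * a * b ^ m + (suc (suc m) * a * b ^ suc m + b ^ suc (suc m))
      ≡⟨ factor a b (b ^ m) m ⟩
    (a + b) * (suc m * a * b ^ m + b ^ suc m)
      ≤⟨ *-monoʳ-≤ (a + b) ([1+m]*a*b^m+b^[1+m]≤[a+b]^[1+m] a b m) ⟩
    (a + b) ^ suc (suc m) ∎
    where
    factor : ∀ a b B m →
      suc m * a * a * B + (suc (suc m) * a * (b * B) + b * (b * B)) ≡ (a + b) * (suc m * a * B + b * B)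
    factor = solve-∀

  nCk*k!≤n^k : ∀ n k → (n C k) * k ! ≤ n ^ k
  nCk*k!≤n^k n       zero    = ≤-refl
  nCk*k!≤n^k zero    (suc k) = z≤n
  nCk*k!≤n^k (suc n) (suc k) = begin
    (suc n C suc k) * suc k !
      ≡⟨ cong (_* suc k !) (sym (nCk+nC[k+1]≡[n+1]C[k+1] n k)) ⟩
    ((n C k) + (n C suc k)) * (suc k * k !)
      ≡⟨ distribute (n C k) (n C suc k) (k !) k ⟩
    suc k * 1 * ((n C k) * k !) + (n C suc k) * suc k !
      ≤⟨ +-mono-≤ (*-monoʳ-≤ (suc k * 1) (nCk*k!≤n^k n k)) (nCk*k!≤n^k n (suc k)) ⟩
    suc k * 1 * n ^ k + n ^ suc k
      ≤⟨ [1+m]*a*b^m+b^[1+m]≤[a+b]^[1+m] 1 n k ⟩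
    suc n ^ suc k ∎
    where
    distribute : ∀ x y f k → (x + y) * (suc k * f) ≡ suc k * 1 * (x * f) + y * (suc k * f)
    distribute = solve-∀

  nCk*n^[n∸k]*k!≤n^n : ∀ {n k} → k ≤ n → (n C k) * n ^ (n ∸ k) * k ! ≤ n ^ n
  nCk*n^[n∸k]*k!≤n^n {n} {k} k≤n = begin
    (n C k) * n ^ (n ∸ k) * k !  ≡⟨ swap (n C k) (n ^ (n ∸ k)) (k !) ⟩
    (n C k) * k ! * n ^ (n ∸ k)  ≤⟨ *-monoˡ-≤ (n ^ (n ∸ k)) (nCk*k!≤n^k n k) ⟩
    n ^ k * n ^ (n ∸ k)          ≡⟨ sym (^-distribˡ-+-* n k (n ∸ k)) ⟩
    n ^ (k + (n ∸ k))            ≡⟨ cong (n ^_) (m+[n∸m]≡n k≤n) ⟩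
    n ^ n                        ∎
    where
    swap : ∀ x y z → x * y * z ≡ x * z * y
    swap = solve-∀

  -- Bernoulli's inequality in the form 1/M ≤ (p/N)^M/M + 1/N, cross-multiplied into exactly
  -- the shape that /-mono-≤, /-* and /-+ below produce.
  1/M≤[p/N]^M/M+1/N : ∀ p m → let N = suc p; M = suc m in
    1 * (N ^ M * M * N) ≤ (p ^ M * 1 * N + 1 * (N ^ M * M)) * M
  1/M≤[p/N]^M/M+1/N p m = begin
    1 * (suc p ^ suc m * suc m * suc p)
      ≡⟨ regroup (suc p) (suc p ^ m) (suc m) ⟩
    suc m * suc p * suc p ^ suc m
      ≤⟨ *-monoʳ-≤ (suc m * suc p) ([a+b]^[1+m]≤b^[1+m]+[1+m]*a*[a+b]^m 1 p m) ⟩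
    suc m * suc p * (p ^ suc m + suc m * 1 * suc p ^ m)
      ≡⟨ expand (p ^ suc m) (suc p) (suc p ^ m) (suc m) ⟩
    (p ^ suc m * 1 * suc p + 1 * (suc p ^ suc m * suc m)) * suc m ∎
    where
    regroup : ∀ N Q M → 1 * (N * Q * M * N) ≡ M * N * (N * Q)
    regroup = solve-∀
    expand : ∀ P N Q M → M * N * (P + M * 1 * Q) ≡ (P * 1 * N + 1 * (N * Q * M)) * M
    expand = solve-∀

open import Data.Rational.Base
open import Data.Rational.Properties
import Data.Rational.Unnormalised.Base as ℚᵘ
import Data.Rational.Unnormalised.Properties as ℚᵘ
open import Data.Rational.Solver using (module +-*-Solver)
open +-*-Solver using (solve; _:+_; _:*_; _:=_; con)

ℚ-commutativeSemiring : CommutativeSemiring _ _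
ℚ-commutativeSemiring = CommutativeRing.commutativeSemiring +-*-commutativeRing

open import Algebra.Properties.CommutativeSemiring.Exp ℚ-commutativeSemiring using (_^_; ^-distrib-*)
import Algebra.Properties.CommutativeSemiring.Binomial ℚ-commutativeSemiring as Binomial
open import Algebra.Definitions.RawMonoid +-0-rawMonoid using (_×_; sum)

fromℕ : ℕ → ℚ
fromℕ n = + n / 1

toℚᵘ-/ : ∀ i d .{{_ : ℕ.NonZero d}} → toℚᵘ (i / d) ℚᵘ.≃ (i ℚᵘ./ d)
toℚᵘ-/ i (suc d) = toℚᵘ-fromℚᵘ (ℚᵘ.mkℚᵘ i d)

/-nonNeg : ∀ a b .{{_ : ℕ.NonZero b}} → 0ℚ ≤ + a / b
/-nonNeg a b = nonNegative⁻¹ (+ a / b) {{normalize-nonNeg a b}}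

/-pos : ∀ a b .{{_ : ℕ.NonZero b}} → 0ℚ < + suc a / b
/-pos a b = positive⁻¹ (+ suc a / b) {{normalize-pos (suc a) b}}

/-mono-≤ : ∀ a b c d .{{_ : ℕ.NonZero b}} .{{_ : ℕ.NonZero d}} →
           a ℕ.* d ℕ.≤ c ℕ.* b → + a / b ≤ + c / d
/-mono-≤ a b@(suc _) c d@(suc _) ad≤cb = toℚᵘ-cancel-≤
  (ℚᵘ.≤-respˡ-≃ (ℚᵘ.≃-sym (toℚᵘ-/ (+ a) b)) (ℚᵘ.≤-respʳ-≃ (ℚᵘ.≃-sym (toℚᵘ-/ (+ c) d))
    (ℚᵘ.*≤* (subst₂ ℤ._≤_ (ℤP.pos-* a d) (ℤP.pos-* c b) (ℤ.+≤+ ad≤cb)))))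

/-≡ : ∀ a b c d .{{_ : ℕ.NonZero b}} .{{_ : ℕ.NonZero d}} →
      a ℕ.* d ≡ c ℕ.* b → + a / b ≡ + c / d
/-≡ a b c d ad≡cb = ≤-antisym (/-mono-≤ a b c d (ℕP.≤-reflexive ad≡cb))
                              (/-mono-≤ c d a b (ℕP.≤-reflexive (sym ad≡cb)))

/-* : ∀ a b c d .{{_ : ℕ.NonZero b}} .{{_ : ℕ.NonZero d}} →
      (+ a / b) * (+ c / d) ≡ (+ (a ℕ.* c) / (b ℕ.* d)) {{ℕP.m*n≢0 b d}}
/-* a b@(suc _) c d@(suc _) = toℚᵘ-injective (begin-equality
  toℚᵘ (+ a / b * (+ c / d))          ≃⟨ toℚᵘ-homo-* (+ a / b) (+ c / d) ⟩
  toℚᵘ (+ a / b) ℚᵘ.* toℚᵘ (+ c / d)  ≃⟨ ℚᵘ.*-cong (toℚᵘ-/ (+ a) b) (toℚᵘ-/ (+ c) d) ⟩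
  (+ a ℤ.* + c) ℚᵘ./ (b ℕ.* d)        ≡⟨ cong (ℚᵘ._/ (b ℕ.* d)) (sym (ℤP.pos-* a c)) ⟩
  + (a ℕ.* c) ℚᵘ./ (b ℕ.* d)          ≃⟨ toℚᵘ-/ (+ (a ℕ.* c)) (b ℕ.* d) ⟨
  toℚᵘ (+ (a ℕ.* c) / (b ℕ.* d))      ∎)
  where open ℚᵘ.≤-Reasoning

/-+ : ∀ a b c d .{{_ : ℕ.NonZero b}} .{{_ : ℕ.NonZero d}} →
      (+ a / b) + (+ c / d) ≡ (+ (a ℕ.* d ℕ.+ c ℕ.* b) / (b ℕ.* d)) {{ℕP.m*n≢0 b d}}
/-+ a b@(suc _) c d@(suc _) = toℚᵘ-injective (begin-equality
  toℚᵘ (+ a / b + + c / d)                    ≃⟨ toℚᵘ-homo-+ (+ a / b) (+ c / d) ⟩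
  toℚᵘ (+ a / b) ℚᵘ.+ toℚᵘ (+ c / d)          ≃⟨ ℚᵘ.+-cong (toℚᵘ-/ (+ a) b) (toℚᵘ-/ (+ c) d) ⟩
  (+ a ℤ.* + d ℤ.+ + c ℤ.* + b) ℚᵘ./ (b ℕ.* d) ≡⟨ cong (ℚᵘ._/ (b ℕ.* d)) numerator ⟩
  + (a ℕ.* d ℕ.+ c ℕ.* b) ℚᵘ./ (b ℕ.* d)      ≃⟨ toℚᵘ-/ (+ (a ℕ.* d ℕ.+ c ℕ.* b)) (b ℕ.* d) ⟨
  toℚᵘ (+ (a ℕ.* d ℕ.+ c ℕ.* b) / (b ℕ.* d))  ∎)
  where
  open ℚᵘ.≤-Reasoning
  numerator : + a ℤ.* + d ℤ.+ + c ℤ.* + b ≡ + (a ℕ.* d ℕ.+ c ℕ.* b)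
  numerator = trans (cong₂ ℤ._+_ (sym (ℤP.pos-* a d)) (sym (ℤP.pos-* c b)))
                    (sym (ℤP.pos-+ (a ℕ.* d) (c ℕ.* b)))

open ≤-Reasoning

fromℕ-+ : ∀ a b → fromℕ (a ℕ.+ b) ≡ fromℕ a + fromℕ b
fromℕ-+ a b = begin-equality
  + (a ℕ.+ b) / 1
    ≡⟨ cong (λ c → + c / 1) (cong₂ ℕ._+_ (ℕP.*-identityʳ a) (ℕP.*-identityʳ b)) ⟨
  + (a ℕ.* 1 ℕ.+ b ℕ.* 1) / 1
    ≡⟨ /-+ a 1 b 1 ⟨
  fromℕ a + fromℕ b ∎

fromℕ-suc : ∀ n → fromℕ (suc n) ≡ 1ℚ + fromℕ n
fromℕ-suc = fromℕ-+ 1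

fromℕ-* : ∀ a b → fromℕ (a ℕ.* b) ≡ fromℕ a * fromℕ b
fromℕ-* a b = sym (/-* a 1 b 1)

fromℕ-^ : ∀ a n → fromℕ a ^ n ≡ fromℕ (a ℕ.^ n)
fromℕ-^ a zero    = refl
fromℕ-^ a (suc n) = trans (cong (fromℕ a *_) (fromℕ-^ a n)) (sym (fromℕ-* a (a ℕ.^ n)))

×-fromℕ : ∀ n a → n × fromℕ a ≡ fromℕ (n ℕ.* a)
×-fromℕ zero    a = refl
×-fromℕ (suc n) a = trans (cong (_+_ (fromℕ a)) (×-fromℕ n a)) (sym (fromℕ-+ a (n ℕ.* a)))

*-mono-≤-nonNeg : ∀ {p q r s} → 0ℚ ≤ p → 0ℚ ≤ r → p ≤ q → r ≤ s → p * r ≤ q * s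
*-mono-≤-nonNeg {p} {q} {r} {s} 0≤p 0≤r p≤q r≤s = begin
  p * r  ≤⟨ *-monoʳ-≤-nonNeg r {{nonNegative 0≤r}} p≤q ⟩
  q * r  ≤⟨ *-monoˡ-≤-nonNeg q {{nonNegative (≤-trans 0≤p p≤q)}} r≤s ⟩
  q * s  ∎

*-nonNeg : ∀ {p q} → 0ℚ ≤ p → 0ℚ ≤ q → 0ℚ ≤ p * q
*-nonNeg {p} {q} 0≤p 0≤q =
  nonNegative⁻¹ (p * q) {{nonNeg*nonNeg⇒nonNeg p {{nonNegative 0≤p}} q {{nonNegative 0≤q}}}}

*-pos : ∀ {p q} → 0ℚ < p → 0ℚ < q → 0ℚ < p * q
*-pos {p} {q} 0<p 0<q = positive⁻¹ (p * q) {{pos*pos⇒pos p {{positive 0<p}} q {{positive 0<q}}}}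

^-nonNeg : ∀ {p} n → 0ℚ ≤ p → 0ℚ ≤ p ^ n
^-nonNeg zero    0≤p = /-nonNeg 1 1
^-nonNeg (suc n) 0≤p = *-nonNeg 0≤p (^-nonNeg n 0≤p)

^-monoˡ-≤-nonNeg : ∀ {p q} n → 0ℚ ≤ p → p ≤ q → p ^ n ≤ q ^ n
^-monoˡ-≤-nonNeg zero    0≤p p≤q = ≤-refl
^-monoˡ-≤-nonNeg (suc n) 0≤p p≤q = *-mono-≤-nonNeg 0≤p (^-nonNeg n 0≤p) p≤q (^-monoˡ-≤-nonNeg n 0≤p p≤q)

p≤p+q : ∀ {p q} → 0ℚ ≤ q → p ≤ p + q
p≤p+q {p} {q} 0≤q = begin
  p       ≡⟨ +-identityʳ p ⟨
  p + 0ℚ  ≤⟨ +-monoʳ-≤ p 0≤q ⟩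
  p + q   ∎

p≤q+p : ∀ {p q} → 0ℚ ≤ q → p ≤ q + p
p≤q+p {p} {q} 0≤q = ≤-trans (p≤p+q 0≤q) (≤-reflexive (+-comm p q))

sumℚ-cong : ∀ m {f g} → (∀ i → f i ≡ g i) → sumℚ m f ≡ sumℚ m g
sumℚ-cong zero    f≗g = refl
sumℚ-cong (suc m) f≗g = cong₂ _+_ (sumℚ-cong m f≗g) (f≗g m)

sumℚ-mono-≤ : ∀ m {f g} → (∀ i → f i ≤ g i) → sumℚ m f ≤ sumℚ m g
sumℚ-mono-≤ zero    f≤g = ≤-refl
sumℚ-mono-≤ (suc m) f≤g = +-mono-≤ (sumℚ-mono-≤ m f≤g) (f≤g m)

sumℚ-nonNeg : ∀ m {f} → (∀ i → 0ℚ ≤ f i) → 0ℚ ≤ sumℚ m f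
sumℚ-nonNeg zero    0≤f = ≤-refl
sumℚ-nonNeg (suc m) 0≤f = +-mono-≤ (sumℚ-nonNeg m 0≤f) (0≤f m)

sumℚ-mono-length : ∀ {m m′} f → (∀ i → 0ℚ ≤ f i) → m ℕ.≤ m′ → sumℚ m f ≤ sumℚ m′ f
sumℚ-mono-length {m} {m′} f 0≤f m≤m′ with ℕP.m≤n⇒∃[o]m+o≡n m≤m′
... | o , refl = extend o
  where
  extend : ∀ o → sumℚ m f ≤ sumℚ (m ℕ.+ o) f
  extend zero    = ≤-reflexive (cong (λ k → sumℚ k f) (sym (ℕP.+-identityʳ m)))
  extend (suc o) = begin
    sumℚ m f                                ≤⟨ extend o ⟩
    sumℚ (m ℕ.+ o) f                        ≤⟨ p≤p+q (0≤f (m ℕ.+ o)) ⟩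
    sumℚ (m ℕ.+ o) f + f (m ℕ.+ o)          ≡⟨ cong (λ k → sumℚ k f) (ℕP.+-suc m o) ⟨
    sumℚ (m ℕ.+ suc o) f                    ∎

sumℚ-suc : ∀ m f → sumℚ (suc m) f ≡ f 0 + sumℚ m (λ i → f (suc i))
sumℚ-suc zero    f = trans (+-identityˡ (f 0)) (sym (+-identityʳ (f 0)))
sumℚ-suc (suc m) f = trans (cong (_+ f (suc m)) (sumℚ-suc m f)) (+-assoc (f 0) _ _)

*-distribʳ-sumℚ : ∀ m c f → sumℚ m f * c ≡ sumℚ m (λ i → f i * c)
*-distribʳ-sumℚ zero    c f = *-zeroˡ c
*-distribʳ-sumℚ (suc m) c f =
  trans (*-distribʳ-+ c (sumℚ m f) (f m)) (cong (_+ f m * c) (*-distribʳ-sumℚ m c f))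

sumℚ-+ : ∀ m f g → sumℚ m (λ i → f i + g i) ≡ sumℚ m f + sumℚ m g
sumℚ-+ zero    f g = sym (+-identityʳ 0ℚ)
sumℚ-+ (suc m) f g = trans (cong (_+ (f m + g m)) (sumℚ-+ m f g))
  (solve 4 (λ a b c d → (a :+ b) :+ (c :+ d) := (a :+ c) :+ (b :+ d)) refl (sumℚ m f) (sumℚ m g) (f m) (g m))

sumℚ-const : ∀ m c → sumℚ m (λ _ → c) ≡ fromℕ m * c
sumℚ-const zero    c = sym (*-zeroˡ c)
sumℚ-const (suc m) c = begin-equality
  sumℚ m (λ _ → c) + c    ≡⟨ cong (_+ c) (sumℚ-const m c) ⟩
  fromℕ m * c + c         ≡⟨ solve 2 (λ x c → x :* c :+ c := (con 1ℚ :+ x) :* c) refl (fromℕ m) c ⟩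
  (1ℚ + fromℕ m) * c      ≡⟨ cong (_* c) (fromℕ-suc m) ⟨
  fromℕ (suc m) * c       ∎

sum≤sumℚ : ∀ m (f : Fin.Fin m → ℚ) g → (∀ i → f i ≤ g (Fin.toℕ i)) → sum f ≤ sumℚ m g
sum≤sumℚ zero    f g f≤g = ≤-refl
sum≤sumℚ (suc m) f g f≤g = begin
  f Fin.zero + sum (λ i → f (Fin.suc i))
    ≤⟨ +-mono-≤ (f≤g Fin.zero) (sum≤sumℚ m _ (λ i → g (suc i)) (λ i → f≤g (Fin.suc i))) ⟩
  g 0 + sumℚ m (λ i → g (suc i))
    ≡⟨ sumℚ-suc m g ⟨
  sumℚ (suc m) g ∎

-- HbarFrom lo n (s ∷ ss) unfolds to sumRange lo n (λ k → oddInvPow k s * HbarFrom (suc k) n ss).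
sumRange : ℕ → ℕ → (ℕ → ℚ) → ℚ
sumRange lo n g = sumℚ (n ∸ lo) (λ i → g (lo ℕ.+ i))

sumRange-step : ∀ {lo n} g → lo ℕ.< n → sumRange lo n g ≡ g lo + sumRange (suc lo) n g
sumRange-step {lo} {suc n} g (s≤s lo≤n) = begin-equality
  sumℚ (suc n ∸ lo) (λ i → g (lo ℕ.+ i))
    ≡⟨ cong (λ m → sumℚ m (λ i → g (lo ℕ.+ i))) (ℕP.+-∸-assoc 1 lo≤n) ⟩
  sumℚ (suc (n ∸ lo)) (λ i → g (lo ℕ.+ i))
    ≡⟨ sumℚ-suc (n ∸ lo) (λ i → g (lo ℕ.+ i)) ⟩
  g (lo ℕ.+ 0) + sumℚ (n ∸ lo) (λ i → g (lo ℕ.+ suc i))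
    ≡⟨ cong₂ _+_ (cong g (ℕP.+-identityʳ lo)) (sumℚ-cong (n ∸ lo) (λ i → cong g (ℕP.+-suc lo i))) ⟩
  g lo + sumRange (suc lo) (suc n) g
    ∎

sumRange-≤-telescope : ∀ {n} (g F : ℕ → ℚ) → (∀ k → 0ℚ ≤ F k) →
  (∀ k → k ℕ.< n → g k + F (suc k) ≤ F k) → ∀ lo → sumRange lo n g ≤ F lo
sumRange-≤-telescope {n} g F 0≤F step lo = go (n ∸ lo) lo refl
  where
  go : ∀ d lo → n ∸ lo ≡ d → sumRange lo n g ≤ F lo
  go zero    lo n∸lo≡0 = begin
    sumRange lo n g  ≡⟨ cong (λ m → sumℚ m (λ i → g (lo ℕ.+ i))) n∸lo≡0 ⟩
    0ℚ               ≤⟨ 0≤F lo ⟩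
    F lo             ∎
  go (suc d) lo n∸lo≡1+d = begin
    sumRange lo n g               ≡⟨ sumRange-step g lo<n ⟩
    g lo + sumRange (suc lo) n g  ≤⟨ +-monoʳ-≤ (g lo) (go d (suc lo) n∸[1+lo]≡d) ⟩
    g lo + F (suc lo)             ≤⟨ step lo lo<n ⟩
    F lo                          ∎
    where
    lo<n : lo ℕ.< n
    lo<n = 0<n∸m⇒m<n (subst (0 ℕ.<_) (sym n∸lo≡1+d) (s≤s z≤n))
    n∸[1+lo]≡d : n ∸ suc lo ≡ d
    n∸[1+lo]≡d = trans (sym (ℕP.pred[m∸n]≡m∸[1+n] n lo)) (cong ℕ.pred n∸lo≡1+d)

[1+m]*a*b^m+b^[1+m]≤[a+b]^[1+m]-nonNeg : ∀ m {a b} → 0ℚ ≤ a → 0ℚ ≤ b →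
  fromℕ (suc m) * a * b ^ m + b ^ suc m ≤ (a + b) ^ suc m
[1+m]*a*b^m+b^[1+m]≤[a+b]^[1+m]-nonNeg zero {a} {b} 0≤a 0≤b = ≤-reflexive
  (solve 2 (λ a b → con 1ℚ :* a :* con 1ℚ :+ b :* con 1ℚ := (a :+ b) :* con 1ℚ) refl a b)
[1+m]*a*b^m+b^[1+m]≤[a+b]^[1+m]-nonNeg (suc m) {a} {b} 0≤a 0≤b = begin
  fromℕ (suc (suc m)) * a * (b * B) + b * (b * B)
    ≡⟨ cong (λ x → x * a * (b * B) + b * (b * B)) (fromℕ-suc (suc m)) ⟩
  (1ℚ + c) * a * (b * B) + b * (b * B)
    ≤⟨ p≤q+p (*-nonNeg (*-nonNeg (*-nonNeg (/-nonNeg (suc m) 1) 0≤a) 0≤a) (^-nonNeg m 0≤b)) ⟩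
  c * a * a * B + ((1ℚ + c) * a * (b * B) + b * (b * B))
    ≡⟨ solve 4 (λ a b c B → c :* a :* a :* B :+ ((con 1ℚ :+ c) :* a :* (b :* B) :+ b :* (b :* B))
                           := (a :+ b) :* (c :* a :* B :+ b :* B)) refl a b c B ⟩
  (a + b) * (c * a * B + b * B)
    ≤⟨ *-monoˡ-≤-nonNeg (a + b) {{nonNegative (+-mono-≤ 0≤a 0≤b)}}
         ([1+m]*a*b^m+b^[1+m]≤[a+b]^[1+m]-nonNeg m 0≤a 0≤b) ⟩
  (a + b) * (a + b) ^ suc m ∎
  where
  B = b ^ m
  c = fromℕ (suc m)

oddInvPow-nonNeg : ∀ k s → 0ℚ ≤ oddInvPow k s
oddInvPow-nonNeg k s = /-nonNeg 1 (suc (2 ℕ.* k) ℕ.^ s) {{ℕP.m^n≢0 (suc (2 ℕ.* k)) s}}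

oddInvPow-pos : ∀ k s → 0ℚ < oddInvPow k s
oddInvPow-pos k s = /-pos 0 (suc (2 ℕ.* k) ℕ.^ s) {{ℕP.m^n≢0 (suc (2 ℕ.* k)) s}}

oddInvPow-antimono : ∀ k {s t} → s ℕ.≤ t → oddInvPow k t ≤ oddInvPow k s
oddInvPow-antimono k {s} {t} s≤t =
  /-mono-≤ 1 (suc (2 ℕ.* k) ℕ.^ t) 1 (suc (2 ℕ.* k) ℕ.^ s)
    {{ℕP.m^n≢0 (suc (2 ℕ.* k)) t}} {{ℕP.m^n≢0 (suc (2 ℕ.* k)) s}}
    (ℕP.*-monoʳ-≤ 1 (ℕP.^-monoʳ-≤ (suc (2 ℕ.* k)) s≤t))

HbarFrom-nonNeg : ∀ n {r} (s : Vec ℕ r) lo → 0ℚ ≤ HbarFrom lo n s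
HbarFrom-nonNeg n []       lo = /-nonNeg 1 1
HbarFrom-nonNeg n (s ∷ ss) lo = sumℚ-nonNeg (n ∸ lo) (λ i →
  *-nonNeg (oddInvPow-nonNeg (lo ℕ.+ i) s) (HbarFrom-nonNeg n ss (suc (lo ℕ.+ i))))

HbarFrom-pos : ∀ n {r} (s : Vec ℕ r) lo → r ℕ.≤ n ∸ lo → 0ℚ < HbarFrom lo n s
HbarFrom-pos n []       lo _        = /-pos 0 1
HbarFrom-pos n {suc r} (s ∷ ss) lo 1+r≤n∸lo = begin-strict
  0ℚ                                  ≡⟨ +-identityʳ 0ℚ ⟨
  0ℚ + 0ℚ                             <⟨ +-mono-<-≤ first-pos rest-nonNeg ⟩
  term lo + sumRange (suc lo) n term  ≡⟨ sumRange-step term lo<n ⟨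
  HbarFrom lo n (s ∷ ss)              ∎
  where
  term : ℕ → ℚ
  term k = oddInvPow k s * HbarFrom (suc k) n ss
  lo<n : lo ℕ.< n
  lo<n = 0<n∸m⇒m<n (ℕP.≤-trans (s≤s z≤n) 1+r≤n∸lo)
  r≤n∸[1+lo] : r ℕ.≤ n ∸ suc lo
  r≤n∸[1+lo] = subst (r ℕ.≤_) (ℕP.pred[m∸n]≡m∸[1+n] n lo) (ℕP.pred-mono-≤ 1+r≤n∸lo)
  first-pos : 0ℚ < term lo
  first-pos = *-pos (oddInvPow-pos lo s) (HbarFrom-pos n ss (suc lo) r≤n∸[1+lo])
  rest-nonNeg : 0ℚ ≤ sumRange (suc lo) n term
  rest-nonNeg = sumℚ-nonNeg (n ∸ suc lo) (λ i →
    *-nonNeg (oddInvPow-nonNeg (suc lo ℕ.+ i) s) (HbarFrom-nonNeg n ss (suc (suc lo ℕ.+ i))))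

oddHarmonicFrom : ℕ → ℕ → ℚ
oddHarmonicFrom lo n = sumRange lo n (λ k → oddInvPow k 1)

oddHarmonicFrom-nonNeg : ∀ lo n → 0ℚ ≤ oddHarmonicFrom lo n
oddHarmonicFrom-nonNeg lo n = sumℚ-nonNeg (n ∸ lo) (λ i → oddInvPow-nonNeg (lo ℕ.+ i) 1)

HbarFrom*r!≤oddHarmonicFrom^r : ∀ n {r} (s : Vec ℕ r) → (∀ i → 1 ℕ.≤ lookup s i) →
  ∀ lo → HbarFrom lo n s * fromℕ (r !) ≤ oddHarmonicFrom lo n ^ r
HbarFrom*r!≤oddHarmonicFrom^r n [] 1≤s lo = ≤-reflexive (*-identityˡ 1ℚ)
HbarFrom*r!≤oddHarmonicFrom^r n {suc r} (s ∷ ss) 1≤s lo = begin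
  HbarFrom lo n (s ∷ ss) * fromℕ (suc r !)
    ≡⟨ *-distribʳ-sumℚ (n ∸ lo) (fromℕ (suc r !)) _ ⟩
  sumRange lo n (λ k → oddInvPow k s * HbarFrom (suc k) n ss * fromℕ (suc r !))
    ≤⟨ sumℚ-mono-≤ (n ∸ lo) (λ i → term≤ (lo ℕ.+ i)) ⟩
  sumRange lo n G
    ≤⟨ sumRange-≤-telescope G (λ k → T k ^ suc r) (λ k → ^-nonNeg (suc r) (oddHarmonicFrom-nonNeg k n))
         telescope-step lo ⟩
  T lo ^ suc r ∎
  where
  T : ℕ → ℚ
  T k = oddHarmonicFrom k n
  G : ℕ → ℚ
  G k = fromℕ (suc r) * oddInvPow k 1 * T (suc k) ^ r
  term≤ : ∀ k → oddInvPow k s * HbarFrom (suc k) n ss * fromℕ (suc r !) ≤ G k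
  term≤ k = begin
    x * H * fromℕ (suc r ℕ.* r !)
      ≡⟨ cong (x * H *_) (fromℕ-* (suc r) (r !)) ⟩
    x * H * (fromℕ (suc r) * fromℕ (r !))
      ≡⟨ solve 4 (λ x H c f → x :* H :* (c :* f) := c :* x :* (H :* f)) refl x H (fromℕ (suc r)) (fromℕ (r !)) ⟩
    fromℕ (suc r) * x * (H * fromℕ (r !))
      ≤⟨ *-mono-≤-nonNeg (*-nonNeg (/-nonNeg (suc r) 1) (oddInvPow-nonNeg k s))
                         (*-nonNeg (HbarFrom-nonNeg n ss (suc k)) (/-nonNeg (r !) 1))
           (*-monoˡ-≤-nonNeg (fromℕ (suc r)) {{nonNegative (/-nonNeg (suc r) 1)}} (oddInvPow-antimono k (1≤s Fin.zero)))
           (HbarFrom*r!≤oddHarmonicFrom^r n ss (λ i → 1≤s (Fin.suc i)) (suc k)) ⟩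
    G k ∎
    where
    x = oddInvPow k s
    H = HbarFrom (suc k) n ss
  telescope-step : ∀ k → k ℕ.< n → G k + T (suc k) ^ suc r ≤ T k ^ suc r
  telescope-step k k<n = begin
    G k + T (suc k) ^ suc r
      ≤⟨ [1+m]*a*b^m+b^[1+m]≤[a+b]^[1+m]-nonNeg r (oddInvPow-nonNeg k 1) (oddHarmonicFrom-nonNeg (suc k) n) ⟩
    (oddInvPow k 1 + T (suc k)) ^ suc r
      ≡⟨ cong (_^ suc r) (sumRange-step (λ k → oddInvPow k 1) k<n) ⟨
    T k ^ suc r ∎

halfLogTerm : ℕ → ℕ → ℚ
halfLogTerm n j = (+ ((n ∸ 1) ℕ.^ M) / (suc (n ∸ 1) ℕ.^ M)) {{ℕP.m^n≢0 (suc (n ∸ 1)) M}} * (+ 1 / M)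
  where
  M = suc (2 ℕ.* j)

halfLogTerm-nonNeg : ∀ n j → 0ℚ ≤ halfLogTerm n j
halfLogTerm-nonNeg n j =
  *-nonNeg (/-nonNeg ((n ∸ 1) ℕ.^ M) (suc (n ∸ 1) ℕ.^ M) {{ℕP.m^n≢0 (suc (n ∸ 1)) M}}) (/-nonNeg 1 M)
  where
  M = suc (2 ℕ.* j)

oddInvPow≤halfLogTerm+1/n : ∀ p j → oddInvPow j 1 ≤ halfLogTerm (suc p) j + + 1 / suc p
oddInvPow≤halfLogTerm+1/n p j = begin
  oddInvPow j 1
    ≡⟨ /-cong {p₁ = + 1} refl (ℕP.*-identityʳ M) ⟩
  + 1 / M
    ≤⟨ /-mono-≤ 1 M (p ℕ.^ M ℕ.* 1 ℕ.* N ℕ.+ 1 ℕ.* (N ℕ.^ M ℕ.* M)) (N ℕ.^ M ℕ.* M ℕ.* N) {{_}} {{N^M*M*N≢0}}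
         (1/M≤[p/N]^M/M+1/N p (2 ℕ.* j)) ⟩
  (+ (p ℕ.^ M ℕ.* 1 ℕ.* N ℕ.+ 1 ℕ.* (N ℕ.^ M ℕ.* M)) / (N ℕ.^ M ℕ.* M ℕ.* N)) {{N^M*M*N≢0}}
    ≡⟨ /-+ (p ℕ.^ M ℕ.* 1) (N ℕ.^ M ℕ.* M) 1 N {{N^M*M≢0}} ⟨
  (+ (p ℕ.^ M ℕ.* 1) / (N ℕ.^ M ℕ.* M)) {{N^M*M≢0}} + + 1 / N
    ≡⟨ cong (_+ + 1 / N) (/-* (p ℕ.^ M) (N ℕ.^ M) 1 M {{ℕP.m^n≢0 N M}}) ⟨
  halfLogTerm (suc p) j + + 1 / N ∎
  where
  N = suc p
  M = suc (2 ℕ.* j)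
  N^M*M≢0 : ℕ.NonZero (N ℕ.^ M ℕ.* M)
  N^M*M≢0 = ℕP.m*n≢0 (N ℕ.^ M) M {{ℕP.m^n≢0 N M}}
  N^M*M*N≢0 : ℕ.NonZero (N ℕ.^ M ℕ.* M ℕ.* N)
  N^M*M*N≢0 = ℕP.m*n≢0 (N ℕ.^ M ℕ.* M) N {{N^M*M≢0}}

fromℕ*1/n≡1 : ∀ n .{{_ : ℕ.NonZero n}} → fromℕ n * (+ 1 / n) ≡ 1ℚ
fromℕ*1/n≡1 n = trans (/-* n 1 1 n) (/-≡ (n ℕ.* 1) (1 ℕ.* n) 1 1 {{ℕP.m*n≢0 1 n}}
  (trans (ℕP.*-comm (n ℕ.* 1) 1) (cong (1 ℕ.*_) (ℕP.*-comm n 1))))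

oddHarmonic≤halfLogPartial+1 : ∀ p {K} → suc p ℕ.≤ K → oddHarmonicFrom 0 (suc p) ≤ halfLogPartial (suc p) K + 1ℚ
oddHarmonic≤halfLogPartial+1 p {K} n≤K = begin
  sumℚ n (λ j → oddInvPow j 1)
    ≤⟨ sumℚ-mono-≤ n (oddInvPow≤halfLogTerm+1/n p) ⟩
  sumℚ n (λ j → halfLogTerm n j + + 1 / n)
    ≡⟨ sumℚ-+ n (halfLogTerm n) (λ _ → + 1 / n) ⟩
  halfLogPartial n n + sumℚ n (λ _ → + 1 / n)
    ≡⟨ cong (_+_ (halfLogPartial n n)) (trans (sumℚ-const n (+ 1 / n)) (fromℕ*1/n≡1 n)) ⟩
  halfLogPartial n n + 1ℚ
    ≤⟨ +-monoˡ-≤ 1ℚ (sumℚ-mono-length (halfLogTerm n) (halfLogTerm-nonNeg n) n≤K) ⟩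
  halfLogPartial n K + 1ℚ ∎
  where
  n = suc p

invFact : ℕ → ℚ
invFact j = (+ 1 / j !) {{j ℕP.!≢0}}

invFact-nonNeg : ∀ j → 0ℚ ≤ invFact j
invFact-nonNeg j = /-nonNeg 1 (j !) {{j ℕP.!≢0}}

[1+m]^m≤ePartial*m^m : ∀ {m K} → m ℕ.< K → fromℕ (suc m) ^ m ≤ ePartial K * fromℕ m ^ m
[1+m]^m≤ePartial*m^m {m} {K} m<K = begin
  fromℕ (suc m) ^ m                             ≡⟨ cong (_^ m) (fromℕ-suc m) ⟩
  (1ℚ + fromℕ m) ^ m                            ≡⟨ Binomial.theorem m 1ℚ (fromℕ m) ⟩
  Binomial.binomialExpansion 1ℚ (fromℕ m) m
    ≤⟨ sum≤sumℚ (suc m) _ (λ k → invFact k * fromℕ m ^ m)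
         (λ k → binomialTerm≤ (Fin.toℕ k) (Fin.toℕ≤pred[n] k)) ⟩
  sumℚ (suc m) (λ k → invFact k * fromℕ m ^ m)  ≡⟨ *-distribʳ-sumℚ (suc m) (fromℕ m ^ m) invFact ⟨
  ePartial (suc m) * fromℕ m ^ m
    ≤⟨ *-monoʳ-≤-nonNeg (fromℕ m ^ m) {{nonNegative (^-nonNeg m (/-nonNeg m 1))}}
         (sumℚ-mono-length invFact invFact-nonNeg m<K) ⟩
  ePartial K * fromℕ m ^ m                      ∎
  where
  binomialTerm≤ : ∀ k → k ℕ.≤ m → (m C k) × (1ℚ ^ k * fromℕ m ^ (m ∸ k)) ≤ invFact k * fromℕ m ^ m
  binomialTerm≤ k k≤m = begin
    (m C k) × (1ℚ ^ k * fromℕ m ^ (m ∸ k))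
      ≡⟨ cong ((m C k) ×_) (cong₂ _*_ (fromℕ-^ 1 k) (fromℕ-^ m (m ∸ k))) ⟩
    (m C k) × (fromℕ (1 ℕ.^ k) * fromℕ (m ℕ.^ (m ∸ k)))
      ≡⟨ cong (λ x → (m C k) × (fromℕ x * fromℕ (m ℕ.^ (m ∸ k)))) (ℕP.^-zeroˡ k) ⟩
    (m C k) × (1ℚ * fromℕ (m ℕ.^ (m ∸ k)))
      ≡⟨ cong ((m C k) ×_) (*-identityˡ (fromℕ (m ℕ.^ (m ∸ k)))) ⟩
    (m C k) × fromℕ (m ℕ.^ (m ∸ k))
      ≡⟨ ×-fromℕ (m C k) (m ℕ.^ (m ∸ k)) ⟩
    fromℕ ((m C k) ℕ.* m ℕ.^ (m ∸ k))
      ≤⟨ /-mono-≤ ((m C k) ℕ.* m ℕ.^ (m ∸ k)) 1 (m ℕ.^ m) (k !) {{_}} {{k!≢0}}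
           (ℕP.≤-trans (nCk*n^[n∸k]*k!≤n^n k≤m) (ℕP.≤-reflexive (sym (ℕP.*-identityʳ (m ℕ.^ m))))) ⟩
    (+ (m ℕ.^ m) / k !) {{k!≢0}}
      ≡⟨ /-cong {p₁ = + (1 ℕ.* m ℕ.^ m)} {{ℕP.m*n≢0 (k !) 1 {{k!≢0}}}} {{k!≢0}}
           (cong +_ (ℕP.*-identityˡ (m ℕ.^ m))) (ℕP.*-identityʳ (k !)) ⟨
    (+ (1 ℕ.* m ℕ.^ m) / (k ! ℕ.* 1)) {{ℕP.m*n≢0 (k !) 1 {{k!≢0}}}}
      ≡⟨ /-* 1 (k !) (m ℕ.^ m) 1 {{k!≢0}} ⟨
    invFact k * fromℕ (m ℕ.^ m)
      ≡⟨ cong (invFact k *_) (fromℕ-^ m m) ⟨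
    invFact k * fromℕ m ^ m ∎
    where
    k!≢0 = k ℕP.!≢0

1<ePartial : ∀ {K} → 2 ℕ.≤ K → 1ℚ < ePartial K
1<ePartial 2≤K = <-≤-trans 1<ePartial2 (sumℚ-mono-length invFact invFact-nonNeg 2≤K)
  where
  1<ePartial2 : 1ℚ < ePartial 2
  1<ePartial2 = *<* (ℤ.+<+ (s≤s (s≤s z≤n)))

[1+m]^[1+m]<[1+m]!*E^[1+m] : ∀ {E} m → 1ℚ < E → (∀ k → k ℕ.≤ m → fromℕ (suc k) ^ k ≤ E * fromℕ k ^ k) →
  fromℕ (suc m) ^ suc m < fromℕ (suc m !) * E ^ suc m
[1+m]^[1+m]<[1+m]!*E^[1+m] {E} zero 1<E _ = begin-strict
  1ℚ * 1ℚ         ≡⟨ *-identityʳ 1ℚ ⟩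
  1ℚ              <⟨ 1<E ⟩
  E               ≡⟨ trans (*-identityˡ (E * 1ℚ)) (*-identityʳ E) ⟨
  1ℚ * (E * 1ℚ)   ∎
[1+m]^[1+m]<[1+m]!*E^[1+m] {E} (suc m) 1<E e-bound = begin-strict
  N * N ^ suc m
    ≤⟨ *-monoˡ-≤-nonNeg N {{nonNegative (/-nonNeg (suc (suc m)) 1)}} (e-bound (suc m) ℕP.≤-refl) ⟩
  N * (E * P ^ suc m)
    ≡⟨ *-assoc N E (P ^ suc m) ⟨
  N * E * P ^ suc m
    <⟨ *-monoʳ-<-pos (N * E) {{positive (*-pos (/-pos (suc m) 1) (<-trans (/-pos 0 1) 1<E))}}
         ([1+m]^[1+m]<[1+m]!*E^[1+m] m 1<E (λ k k≤m → e-bound k (ℕP.m≤n⇒m≤1+n k≤m))) ⟩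
  N * E * (fromℕ (suc m !) * E ^ suc m)
    ≡⟨ solve 4 (λ N E F X → N :* E :* (F :* X) := N :* F :* (E :* X)) refl N E (fromℕ (suc m !)) (E ^ suc m) ⟩
  N * fromℕ (suc m !) * (E * E ^ suc m)
    ≡⟨ cong (_* (E * E ^ suc m)) (fromℕ-* (suc (suc m)) (suc m !)) ⟨
  fromℕ (suc (suc m) !) * E ^ suc (suc m) ∎
  where
  N = fromℕ (suc (suc m))
  P = fromℕ (suc m)

0<q<1⇒¬IsInteger : ∀ {q} → 0ℚ < q → q < 1ℚ → ¬ IsInteger q
0<q<1⇒¬IsInteger 0<q q<1 (+ zero   , refl) = <-irrefl refl 0<q
0<q<1⇒¬IsInteger 0<q q<1 (+ suc k  , refl) = <-irrefl refl (<-≤-trans q<1 (/-mono-≤ 1 1 (suc k) 1 (s≤s z≤n)))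
0<q<1⇒¬IsInteger 0<q q<1 (-[1+ k ] , refl) =
  <-asym 0<q (negative⁻¹ (-[1+ k ] / 1) {{neg-pos {normalize (suc k) 1} (normalize-pos (suc k) 1)}})

Hbar<1 : ∀ n {r} (s : Vec ℕ (suc r)) {E} → (∀ i → 1 ℕ.≤ lookup s i) → 1ℚ < E →
  (∀ k → k ℕ.≤ r → fromℕ (suc k) ^ k ≤ E * fromℕ k ^ k) → E * oddHarmonicFrom 0 n ≤ fromℕ (suc r) →
  Hbar n s < 1ℚ
Hbar<1 n {r} s {E} 1≤s 1<E e-bound E*T≤1+r = *-cancelʳ-<-nonNeg Q {{nonNegative 0≤Q}} (begin-strict
  Hbar n s * (fromℕ (suc r !) * E ^ suc r)
    ≡⟨ solve 3 (λ h f e → h :* (f :* e) := e :* (h :* f)) refl (Hbar n s) (fromℕ (suc r !)) (E ^ suc r) ⟩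
  E ^ suc r * (Hbar n s * fromℕ (suc r !))
    ≤⟨ *-monoˡ-≤-nonNeg (E ^ suc r) {{nonNegative (^-nonNeg (suc r) 0≤E)}}
         (HbarFrom*r!≤oddHarmonicFrom^r n s 1≤s 0) ⟩
  E ^ suc r * T ^ suc r
    ≡⟨ ^-distrib-* E T (suc r) ⟨
  (E * T) ^ suc r
    ≤⟨ ^-monoˡ-≤-nonNeg (suc r) (*-nonNeg 0≤E (oddHarmonicFrom-nonNeg 0 n)) E*T≤1+r ⟩
  fromℕ (suc r) ^ suc r
    <⟨ [1+m]^[1+m]<[1+m]!*E^[1+m] r 1<E e-bound ⟩
  Q
    ≡⟨ *-identityˡ Q ⟨
  1ℚ * Q ∎)
  where
  T = oddHarmonicFrom 0 n
  Q = fromℕ (suc r !) * E ^ suc r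
  0≤E : 0ℚ ≤ E
  0≤E = <⇒≤ (<-trans (/-pos 0 1) 1<E)
  0≤Q : 0ℚ ≤ Q
  0≤Q = *-nonNeg (/-nonNeg (suc r !) 1) (^-nonNeg (suc r) 0≤E)

lemma2p3 : (r n : ℕ) → 1 ℕ.≤ r → 1 ℕ.≤ n → BoundHolds r n → r ℕ.≤ n →
    (s : Vec ℕ r) → (∀ (i : Fin.Fin r) → 1 ℕ.≤ lookup s i) →
    ¬ IsInteger (Hbar n s)
lemma2p3 (suc r) (suc p) (s≤s z≤n) (s≤s z≤n) bound r<n s 1≤s =
  0<q<1⇒¬IsInteger (HbarFrom-pos n s 0 r<n) (Hbar<1 n s 1≤s 1<E e-bound E*T≤1+r)
  where
  n = suc p
  E = ePartial (suc n)
  1<E : 1ℚ < E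
  1<E = 1<ePartial {suc n} (s≤s (s≤s z≤n))
  e-bound : ∀ k → k ℕ.≤ r → fromℕ (suc k) ^ k ≤ E * fromℕ k ^ k
  e-bound k k≤r = [1+m]^m≤ePartial*m^m (s≤s (ℕP.≤-trans k≤r (ℕP.<⇒≤ r<n)))
  E*T≤1+r : E * oddHarmonicFrom 0 n ≤ fromℕ (suc r)
  E*T≤1+r = ≤-trans (*-monoˡ-≤-nonNeg E {{nonNegative (<⇒≤ (<-trans (/-pos 0 1) 1<E))}}
                      (oddHarmonic≤halfLogPartial+1 p (ℕP.n≤1+n n)))
                    (bound (suc n))
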